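{- Let $h(x)=\sum_{k\ge1}h_kx^k\in\mathbb{K}[[x]]$ with $h_k\ne0$ for all $k\ge1$, and set $h_0=0$. Let $(L_k^h)_{k\ge0}$ be the unique sequence of polynomials such that $\mathcal{D}_h(p)=\sum_{j\ge0}L_j^h(x)\,\mathcal{D}^{(j)}(p)$ for every polynomial $p$. Then for every $k\ge0$, $$L_k^h(x)=\frac{x^{k-1}}{k!}\sum_{j=0}^k(-1)^{k+j}\binom{k}{j}h_j.$$
   Context: $\mathbb{K}$ is a field of characteristic zero. The $h$-derivative is $\mathcal{D}_h\big(\sum_{k\ge0}s_kx^k\big)=\sum_{k\ge1}h_ks_kx^{k-1}$, so $\mathcal{D}_h(x^k)=h_kx^{k-1}$. $\mathcal{D}$ is the usual derivative and $\mathcal{D}^{(j)}$ its $j$-fold composition ($\mathcal{D}^{(0)}$ the identity). The defining identity applied to $x^k$ reads $h_kx^{k-1}=\sum_{j=0}^k\binom{k}{j}j!\,L_j^h(x)x^{k-j}$ for all $k\ge0$, which determines the $L_j^h$ uniquely (by a result of Sheffer they exist with $\deg L_k^h\le k-1$); the same expansion then holds on all of $\mathbb{K}[[x]]$. -}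

module Defs where

open import Level using (Level; _⊔_) renaming (suc to lsuc)
open import Algebra.Bundles using (CommutativeRing)
open import Data.Nat using (ℕ; zero; suc; _∸_; _!; _≟_) renaming (_+_ to _+ℕ_)
open import Data.Nat.Combinatorics using (_C_)
open import Data.List using (List; []; _∷_; length)
open import Relation.Nullary using (¬_; yes; no)

-- A field: a commutative ring with 1 ≠ 0 and a (total) inverse map that is a
-- genuine inverse on every nonzero element (value at 0 is irrelevant).
record Field (c ℓ : Level) : Set (lsuc (c ⊔ ℓ)) where
  field
    commutativeRing : CommutativeRing c ℓ
  open CommutativeRing commutativeRing public
  field
    _⁻¹ : Carrier → Carrier
    ⁻¹-inverse : ∀ x → ¬ (x ≈ 0#) → (x * (x ⁻¹)) ≈ 1#
    1≉0 : ¬ (1# ≈ 0#)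

module FieldOps {c ℓ : Level} (F : Field c ℓ) where
  open Field F

  fromℕ : ℕ → Carrier
  fromℕ zero = 0#
  fromℕ (suc n) = 1# + fromℕ n

  CharZero : Set ℓ
  CharZero = ∀ n → ¬ (fromℕ (suc n) ≈ 0#)

  pow : Carrier → ℕ → Carrier
  pow x zero = 1#
  pow x (suc n) = x * pow x n

  sumBelow : ℕ → (ℕ → Carrier) → Carrier
  sumBelow zero f = 0#
  sumBelow (suc n) f = sumBelow n f + f n

  -- formal power series / polynomials, given by coefficient sequences
  Seq : Set c
  Seq = ℕ → Carrier

  -- polynomials as finite coefficient lists [p₀, p₁, …, p_d]
  Poly : Set c
  Poly = List Carrier

  coeff : Poly → Seq
  coeff [] n = 0#
  coeff (a ∷ p) zero = a
  coeff (a ∷ p) (suc n) = coeff p n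

  mul : Seq → Seq → Seq
  mul f g n = sumBelow (suc n) (λ i → f i * g (n ∸ i))

  D : Seq → Seq
  D f n = fromℕ (suc n) * f (suc n)

  Diter : ℕ → Seq → Seq
  Diter zero f = f
  Diter (suc j) f = D (Diter j f)

  Dh : Seq → Seq → Seq
  Dh h s n = h (suc n) * s (suc n)

  -- coefficients of Σ_{j ≥ 0} L_j(x) D^(j)(p) for a polynomial p.
  -- D^(j)(p) = 0 for j ≥ length p, so the sum over j < length p is the full sum.
  seriesOp : (ℕ → Poly) → Poly → Seq
  seriesOp L p n = sumBelow (length p) (λ j → mul (coeff (L j)) (Diter j (coeff p)) n)

  -- coefficients of  x^{k-1}/k! · Σ_{j=0}^k (-1)^{k+j} C(k,j) h_j
  -- (for k = 0 this is the zero polynomial, as h_0 = 0)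
  formulaCoeff : Seq → ℕ → Seq
  formulaCoeff h k n with suc n ≟ k
  ... | yes _ = (fromℕ (k !) ⁻¹) *
                sumBelow (suc k) (λ j → pow (- 1#) (k +ℕ j) * (fromℕ (k C j) * h j))
  ... | no _ = 0#

{-# OPTIONS --safe #-}
-- Apply the expansion to p = x^k and compare the coefficients of x^n.  Since
-- D^(j)(x^k) = k(k-1)⋯(k-j+1) x^(k-j), only the coefficients L_j[n+j-k] with
-- j ≤ k contribute, and L_k[n] enters with the factor k!.  Strong induction on
-- k then shows that L_k[n] = 0 unless n = k - 1 (characteristic zero lets us
-- divide by k!).  Writing d_j = j! L_j[j-1], the coefficient of x^(k-1) reads
-- h_k = Σ_j C(k,j) d_j, and binomial inversion, obtained by applying the
-- forward difference k times at 0, gives d_k = Σ_j (-1)^(k+j) C(k,j) h_j.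
module Submission where

open import Defs
open import Data.Nat as ℕ using (ℕ; zero; suc; pred; _!; _≤_; _<_; NonZero; s≤s; s≤s⁻¹)
import Data.Nat.Properties as ℕₚ
open ℕₚ using (m<n⇒m<1+n; n<1+n; <⇒≢; ≤∧≢⇒<; n∸n≡0; suc-injective; _!≢0)
open import Data.Nat.Combinatorics using (_C_; nCk+nC[k+1]≡[n+1]C[k+1]; k>n⇒nCk≡0)
open import Data.Nat.Induction using (<-rec)
open import Data.List using ([]; _∷_; length)
open import Function using (_∘_)
open import Relation.Binary.PropositionalEquality as ≡ using (_≡_; _≢_; cong)
open import Relation.Nullary using (¬_; yes; no; contradiction)

module Arithmetic where
  open import Data.Nat
  open import Data.Nat.Properties
  open import Data.Nat.Combinatorics using (nCk≡n!/k![n-k]!; k![n∸k]!∣n!)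
  open import Data.Nat.DivMod using (m/n*n≡m)
  open import Relation.Binary.PropositionalEquality
  open import Algebra.Properties.CommutativeSemigroup *-commutativeSemigroup using (xy∙z≈y∙xz)
  open ≡-Reasoning

  rising : ℕ → ℕ → ℕ
  rising m zero = 1
  rising m (suc j) = suc m * rising (suc m) j

  rising*!≡! : ∀ m j → rising m j * m ! ≡ (m + j) !
  rising*!≡! m zero = trans (*-identityˡ (m !)) (cong _! (sym (+-identityʳ m)))
  rising*!≡! m (suc j) = begin
    suc m * rising (suc m) j * m ! ≡⟨ xy∙z≈y∙xz (suc m) (rising (suc m) j) (m !) ⟩
    rising (suc m) j * suc m !     ≡⟨ rising*!≡! (suc m) j ⟩
    (suc m + j) !                  ≡⟨ cong _! (+-suc m j) ⟨
    (m + suc j) !                  ∎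

  rising-zero : ∀ n → rising 0 n ≡ n !
  rising-zero n = trans (sym (*-identityʳ (rising 0 n))) (rising*!≡! 0 n)

  nCk*[k!*[n∸k]!]≡n! : ∀ {n k} → k ≤ n → (n C k) * (k ! * (n ∸ k) !) ≡ n !
  nCk*[k!*[n∸k]!]≡n! {n} {k} k≤n =
    trans (cong (_* (k ! * (n ∸ k) !)) (nCk≡n!/k![n-k]! k≤n)) (m/n*n≡m (k![n∸k]!∣n! k≤n))
    where instance _ = k !* (n ∸ k) !≢0

  rising≡C*! : ∀ m j → rising m j ≡ ((m + j) C j) * j !
  rising≡C*! m j = *-cancelʳ-≡ _ _ (m !) {{m !≢0}} (begin
    rising m j * m !                      ≡⟨ rising*!≡! m j ⟩
    (m + j) !                             ≡⟨ nCk*[k!*[n∸k]!]≡n! (m≤n+m j m) ⟨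
    ((m + j) C j) * (j ! * (m + j ∸ j) !) ≡⟨ cong (λ t → ((m + j) C j) * (j ! * t !)) (m+n∸n≡m m j) ⟩
    ((m + j) C j) * (j ! * m !)           ≡⟨ *-assoc ((m + j) C j) (j !) (m !) ⟨
    ((m + j) C j) * j ! * m !             ∎)

  m∸n+suc[n]≡suc[m] : ∀ {m n} → n ≤ m → m ∸ n + suc n ≡ suc m
  m∸n+suc[n]≡suc[m] {m} {n} n≤m = trans (+-suc (m ∸ n) n) (cong suc (m∸n+n≡m n≤m))

  n<m⇒m∸n+k≢k : ∀ {m n} k → n < m → m ∸ n + k ≢ k
  n<m⇒m∸n+k≢k k n<m eq = m>n⇒m∸n≢0 n<m (+-cancelʳ-≡ k _ 0 eq)

open Arithmetic

module _ {c ℓ} (F : Field c ℓ) where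
  open Field F
  open FieldOps F
  open import Algebra.Properties.Ring ring
    using (-1*x≈-x; -‿distribʳ-*; -‿involutive; -‿+-comm; -0#≈0#; xyx⁻¹≈y; x[y-z]≈xy-xz)
  open import Algebra.Properties.Semiring.Mult semiring using (_×_; ×-homo-+; ×1-homo-*)
  open import Algebra.Properties.Semiring.Exp semiring using (_^_; ^-homo-*)
  open import Algebra.Properties.CommutativeSemigroup +-commutativeSemigroup
    using (interchange; x∙yz≈xz∙y)
  open import Algebra.Properties.CommutativeSemigroup *-commutativeSemigroup
    using (x∙yz≈y∙xz)
  open import Relation.Binary.Reasoning.Setoid setoid

  fromℕ≡×1# : ∀ n → fromℕ n ≡ n × 1#
  fromℕ≡×1# zero = ≡.refl
  fromℕ≡×1# (suc n) = cong (1# +_) (fromℕ≡×1# n)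

  fromℕ-+ : ∀ m n → fromℕ (m ℕ.+ n) ≈ fromℕ m + fromℕ n
  fromℕ-+ m n = ≡.subst₂ _≈_ (≡.sym (fromℕ≡×1# (m ℕ.+ n)))
    (≡.sym (≡.cong₂ _+_ (fromℕ≡×1# m) (fromℕ≡×1# n))) (×-homo-+ 1# m n)

  fromℕ-* : ∀ m n → fromℕ (m ℕ.* n) ≈ fromℕ m * fromℕ n
  fromℕ-* m n = ≡.subst₂ _≈_ (≡.sym (fromℕ≡×1# (m ℕ.* n)))
    (≡.sym (≡.cong₂ _*_ (fromℕ≡×1# m) (fromℕ≡×1# n))) (×1-homo-* m n)

  fromℕ-≉0 : CharZero → ∀ n → .{{NonZero n}} → ¬ (fromℕ n ≈ 0#)
  fromℕ-≉0 charZero (suc n) = charZero n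

  pow≡^ : ∀ x n → pow x n ≡ x ^ n
  pow≡^ x zero = ≡.refl
  pow≡^ x (suc n) = cong (x *_) (pow≡^ x n)

  pow-+ : ∀ x m n → pow x (m ℕ.+ n) ≈ pow x m * pow x n
  pow-+ x m n = ≡.subst₂ _≈_ (≡.sym (pow≡^ x (m ℕ.+ n)))
    (≡.sym (≡.cong₂ _*_ (pow≡^ x m) (pow≡^ x n))) (^-homo-* x m n)

  -1^suc* : ∀ n x → pow (- 1#) (suc n) * x ≈ - (pow (- 1#) n * x)
  -1^suc* n x = trans (*-assoc (- 1#) (pow (- 1#) n) x) (-1*x≈-x _)

  x*y≈z⇒x≈y⁻¹*z : ∀ {x y z} → ¬ (y ≈ 0#) → x * y ≈ z → x ≈ y ⁻¹ * z
  x*y≈z⇒x≈y⁻¹*z {x} {y} {z} y≉0 xy≈z = begin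
    x              ≈⟨ *-identityʳ x ⟨
    x * 1#         ≈⟨ *-congˡ (⁻¹-inverse y y≉0) ⟨
    x * (y * y ⁻¹) ≈⟨ *-assoc x y (y ⁻¹) ⟨
    x * y * y ⁻¹   ≈⟨ *-congʳ xy≈z ⟩
    z * y ⁻¹       ≈⟨ *-comm z (y ⁻¹) ⟩
    y ⁻¹ * z       ∎

  x*y≈0⇒x≈0 : ∀ {x y} → ¬ (y ≈ 0#) → x * y ≈ 0# → x ≈ 0#
  x*y≈0⇒x≈0 y≉0 xy≈0 = trans (x*y≈z⇒x≈y⁻¹*z y≉0 xy≈0) (zeroʳ _)

  sumBelow-cong : ∀ n {f g : ℕ → Carrier} → (∀ i → i < n → f i ≈ g i) →
                  sumBelow n f ≈ sumBelow n g
  sumBelow-cong zero f≈g = refl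
  sumBelow-cong (suc n) f≈g =
    +-cong (sumBelow-cong n (λ i i<n → f≈g i (m<n⇒m<1+n i<n))) (f≈g n (n<1+n n))

  sumBelow-zero : ∀ n {f : ℕ → Carrier} → (∀ i → i < n → f i ≈ 0#) → sumBelow n f ≈ 0#
  sumBelow-zero zero f≈0 = refl
  sumBelow-zero (suc n) f≈0 = trans
    (+-cong (sumBelow-zero n (λ i i<n → f≈0 i (m<n⇒m<1+n i<n))) (f≈0 n (n<1+n n)))
    (+-identityʳ 0#)

  sumBelow-single : ∀ n {f : ℕ → Carrier} {i} → i < n →
                    (∀ j → j < n → j ≢ i → f j ≈ 0#) → sumBelow n f ≈ f i
  sumBelow-single (suc n) {f} {i} i<1+n others with i ℕ.≟ n
  ... | yes ≡.refl = trans
    (+-congʳ (sumBelow-zero n (λ j j<n → others j (m<n⇒m<1+n j<n) (<⇒≢ j<n))))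
    (+-identityˡ (f n))
  ... | no i≢n = trans
    (+-cong (sumBelow-single n (≤∧≢⇒< (s≤s⁻¹ i<1+n) i≢n)
                               (λ j j<n → others j (m<n⇒m<1+n j<n)))
            (others n (n<1+n n) (i≢n ∘ ≡.sym)))
    (+-identityʳ (f i))

  sumBelow-distrib-+ : ∀ n (f g : ℕ → Carrier) →
                       sumBelow n (λ i → f i + g i) ≈ sumBelow n f + sumBelow n g
  sumBelow-distrib-+ zero f g = sym (+-identityʳ 0#)
  sumBelow-distrib-+ (suc n) f g = trans (+-congʳ (sumBelow-distrib-+ n f g)) (interchange _ _ _ _)

  sumBelow-neg : ∀ n (f : ℕ → Carrier) → sumBelow n (λ i → - f i) ≈ - sumBelow n f
  sumBelow-neg zero f = sym -0#≈0#
  sumBelow-neg (suc n) f = trans (+-congʳ (sumBelow-neg n f)) (-‿+-comm _ _)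

  *-distribˡ-sumBelow : ∀ n x (f : ℕ → Carrier) → sumBelow n (λ i → x * f i) ≈ x * sumBelow n f
  *-distribˡ-sumBelow zero x f = sym (zeroʳ x)
  *-distribˡ-sumBelow (suc n) x f =
    trans (+-congʳ (*-distribˡ-sumBelow n x f)) (sym (distribˡ x _ _))

  sumBelow-head : ∀ n (f : ℕ → Carrier) → sumBelow (suc n) f ≈ f 0 + sumBelow n (f ∘ suc)
  sumBelow-head zero f = +-comm 0# (f 0)
  sumBelow-head (suc n) f = trans (+-congʳ (sumBelow-head n f)) (+-assoc _ _ _)

  binomialTransform : Seq → Seq
  binomialTransform a k = sumBelow (suc k) (λ j → fromℕ (k C j) * a j)

  signedBinomialTransform : Seq → Seq
  signedBinomialTransform a k =
    sumBelow (suc k) (λ j → pow (- 1#) (k ℕ.+ j) * (fromℕ (k C j) * a j))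

  alternating : Seq → Seq
  alternating a j = pow (- 1#) j * a j

  Δ : Seq → Seq
  Δ a k = a (suc k) - a k

  Δ^ : ℕ → Seq → Seq
  Δ^ zero a = a
  Δ^ (suc t) a = Δ^ t (Δ a)

  Δ^-cong : ∀ t {a b : Seq} → (∀ k → a k ≈ b k) → ∀ k → Δ^ t a k ≈ Δ^ t b k
  Δ^-cong zero a≈b = a≈b
  Δ^-cong (suc t) a≈b = Δ^-cong t (λ k → +-cong (a≈b (suc k)) (-‿cong (a≈b k)))

  binomialTransform-zero : ∀ a → binomialTransform a 0 ≈ a 0
  binomialTransform-zero a =
    trans (+-identityˡ _) (trans (*-congʳ (+-identityʳ 1#)) (*-identityˡ (a 0)))

  binomialTransform-distrib-+ : ∀ a b k →
    binomialTransform (λ j → a j + b j) k ≈ binomialTransform a k + binomialTransform b k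
  binomialTransform-distrib-+ a b k = trans
    (sumBelow-cong (suc k) (λ j _ → distribˡ (fromℕ (k C j)) (a j) (b j)))
    (sumBelow-distrib-+ (suc k) _ _)

  binomialTransform-neg : ∀ a k → binomialTransform (λ j → - a j) k ≈ - binomialTransform a k
  binomialTransform-neg a k = trans
    (sumBelow-cong (suc k) (λ j _ → sym (-‿distribʳ-* (fromℕ (k C j)) (a j))))
    (sumBelow-neg (suc k) _)

  binomialTransform-pascal : ∀ a k →
    binomialTransform a (suc k) ≈ binomialTransform a k + binomialTransform (a ∘ suc) k
  binomialTransform-pascal a k = begin
    binomialTransform a (suc k)
      ≈⟨ sumBelow-head (suc k) _ ⟩
    a₀ + sumBelow (suc k) (λ j → fromℕ (suc k C suc j) * a (suc j))
      ≈⟨ +-congˡ (sumBelow-cong (suc k) (λ j _ → pascal j)) ⟩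
    a₀ + sumBelow (suc k) (λ j → fromℕ (k C j) * a (suc j) + fromℕ (k C suc j) * a (suc j))
      ≈⟨ +-congˡ (sumBelow-distrib-+ (suc k) _ _) ⟩
    a₀ + (binomialTransform (a ∘ suc) k + rest)
      ≈⟨ x∙yz≈xz∙y a₀ _ rest ⟩
    (a₀ + rest) + binomialTransform (a ∘ suc) k
      ≈⟨ +-congʳ extend ⟩
    binomialTransform a k + binomialTransform (a ∘ suc) k
      ∎
    where
    a₀ = fromℕ (k C 0) * a 0
    rest = sumBelow (suc k) (λ j → fromℕ (k C suc j) * a (suc j))

    pascal : ∀ j → fromℕ (suc k C suc j) * a (suc j)
                 ≈ fromℕ (k C j) * a (suc j) + fromℕ (k C suc j) * a (suc j)
    pascal j = begin
      fromℕ (suc k C suc j) * a (suc j)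
        ≡⟨ cong (λ n → fromℕ n * a (suc j)) (nCk+nC[k+1]≡[n+1]C[k+1] k j) ⟨
      fromℕ (k C j ℕ.+ k C suc j) * a (suc j)
        ≈⟨ *-congʳ (fromℕ-+ (k C j) (k C suc j)) ⟩
      (fromℕ (k C j) + fromℕ (k C suc j)) * a (suc j)
        ≈⟨ distribʳ (a (suc j)) _ _ ⟩
      fromℕ (k C j) * a (suc j) + fromℕ (k C suc j) * a (suc j)
        ∎

    -- the binomial sum for k may run up to k + 1, as C(k, k + 1) = 0
    extend : a₀ + rest ≈ binomialTransform a k
    extend = begin
      a₀ + rest
        ≈⟨ sumBelow-head (suc k) (λ j → fromℕ (k C j) * a j) ⟨
      binomialTransform a k + fromℕ (k C suc k) * a (suc k)
        ≡⟨ cong (λ n → binomialTransform a k + fromℕ n * a (suc k)) (k>n⇒nCk≡0 (n<1+n k)) ⟩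
      binomialTransform a k + 0# * a (suc k)
        ≈⟨ +-congˡ (zeroˡ (a (suc k))) ⟩
      binomialTransform a k + 0#
        ≈⟨ +-identityʳ _ ⟩
      binomialTransform a k
        ∎

  Δ-binomialTransform : ∀ a k → Δ (binomialTransform a) k ≈ binomialTransform (a ∘ suc) k
  Δ-binomialTransform a k = trans (+-congʳ (binomialTransform-pascal a k)) (xyx⁻¹≈y _ _)

  Δ^-binomialTransform : ∀ t a k →
    Δ^ t (binomialTransform a) k ≈ binomialTransform (λ j → a (t ℕ.+ j)) k
  Δ^-binomialTransform zero a k = refl
  Δ^-binomialTransform (suc t) a k =
    trans (Δ^-cong t (Δ-binomialTransform a) k) (Δ^-binomialTransform t (a ∘ suc) k)

  signedBinomialTransform≈alternating : ∀ a k →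
    signedBinomialTransform a k ≈ pow (- 1#) k * binomialTransform (alternating a) k
  signedBinomialTransform≈alternating a k =
    trans (sumBelow-cong (suc k) (λ j _ → term j)) (*-distribˡ-sumBelow (suc k) _ _)
    where
    term : ∀ j → pow (- 1#) (k ℕ.+ j) * (fromℕ (k C j) * a j)
               ≈ pow (- 1#) k * (fromℕ (k C j) * alternating a j)
    term j = begin
      pow (- 1#) (k ℕ.+ j) * (fromℕ (k C j) * a j)             ≈⟨ *-congʳ (pow-+ (- 1#) k j) ⟩
      pow (- 1#) k * pow (- 1#) j * (fromℕ (k C j) * a j)      ≈⟨ *-assoc _ _ _ ⟩
      pow (- 1#) k * (pow (- 1#) j * (fromℕ (k C j) * a j))    ≈⟨ *-congˡ (x∙yz≈y∙xz _ _ _) ⟩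
      pow (- 1#) k * (fromℕ (k C j) * alternating a j)         ∎

  alternating-Δ : ∀ a j → alternating (Δ a) j ≈ - (alternating a j + alternating a (suc j))
  alternating-Δ a j = begin
    ε * (a (suc j) - a j)             ≈⟨ x[y-z]≈xy-xz ε (a (suc j)) (a j) ⟩
    ε * a (suc j) - ε * a j           ≈⟨ +-comm _ _ ⟩
    - (ε * a j) + ε * a (suc j)       ≈⟨ +-congˡ (-‿involutive _) ⟨
    - (ε * a j) + - - (ε * a (suc j)) ≈⟨ -‿+-comm _ _ ⟩
    - (ε * a j + - (ε * a (suc j)))   ≈⟨ -‿cong (+-congˡ (-1^suc* j (a (suc j)))) ⟨
    - (alternating a j + alternating a (suc j)) ∎
    where ε = pow (- 1#) j

  signedBinomialTransform-Δ : ∀ a k →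
    signedBinomialTransform (Δ a) k ≈ signedBinomialTransform a (suc k)
  signedBinomialTransform-Δ a k = begin
    signedBinomialTransform (Δ a) k
      ≈⟨ signedBinomialTransform≈alternating (Δ a) k ⟩
    ε * binomialTransform (alternating (Δ a)) k
      ≈⟨ *-congˡ (sumBelow-cong (suc k) (λ j _ → *-congˡ (alternating-Δ a j))) ⟩
    ε * binomialTransform (λ j → - (b j + b (suc j))) k
      ≈⟨ *-congˡ (binomialTransform-neg _ k) ⟩
    ε * - binomialTransform (λ j → b j + b (suc j)) k
      ≈⟨ *-congˡ (-‿cong (binomialTransform-distrib-+ b (b ∘ suc) k)) ⟩
    ε * - (binomialTransform b k + binomialTransform (b ∘ suc) k)
      ≈⟨ *-congˡ (-‿cong (binomialTransform-pascal b k)) ⟨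
    ε * - binomialTransform b (suc k)
      ≈⟨ -‿distribʳ-* ε _ ⟨
    - (ε * binomialTransform b (suc k))
      ≈⟨ -1^suc* k _ ⟨
    pow (- 1#) (suc k) * binomialTransform b (suc k)
      ≈⟨ signedBinomialTransform≈alternating a (suc k) ⟨
    signedBinomialTransform a (suc k)
      ∎
    where
    ε = pow (- 1#) k
    b = alternating a

  Δ^≈signedBinomialTransform : ∀ k a → Δ^ k a 0 ≈ signedBinomialTransform a k
  Δ^≈signedBinomialTransform zero a =
    sym (trans (+-congˡ (*-identityˡ _)) (binomialTransform-zero a))
  Δ^≈signedBinomialTransform (suc k) a =
    trans (Δ^≈signedBinomialTransform k (Δ a)) (signedBinomialTransform-Δ a k)

  binomial-inversion : ∀ {a d} → (∀ k → a k ≈ binomialTransform d k) →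
                       ∀ k → d k ≈ signedBinomialTransform a k
  binomial-inversion {a} {d} a≈Sd k = begin
    d k                                     ≡⟨ cong d (ℕₚ.+-identityʳ k) ⟨
    d (k ℕ.+ 0)                             ≈⟨ binomialTransform-zero (λ j → d (k ℕ.+ j)) ⟨
    binomialTransform (λ j → d (k ℕ.+ j)) 0 ≈⟨ Δ^-binomialTransform k d 0 ⟨
    Δ^ k (binomialTransform d) 0            ≈⟨ Δ^-cong k (λ j → sym (a≈Sd j)) 0 ⟩
    Δ^ k a 0                                ≈⟨ Δ^≈signedBinomialTransform k a ⟩
    signedBinomialTransform a k             ∎

  monomial : ℕ → Poly
  monomial zero = 1# ∷ []
  monomial (suc k) = 0# ∷ monomial k

  length-monomial : ∀ k → length (monomial k) ≡ suc k
  length-monomial zero = ≡.refl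
  length-monomial (suc k) = cong suc (length-monomial k)

  coeff-monomial-≡ : ∀ k → coeff (monomial k) k ≡ 1#
  coeff-monomial-≡ zero = ≡.refl
  coeff-monomial-≡ (suc k) = coeff-monomial-≡ k

  coeff-monomial-≢ : ∀ {k m} → m ≢ k → coeff (monomial k) m ≡ 0#
  coeff-monomial-≢ {zero} {zero} m≢k = contradiction ≡.refl m≢k
  coeff-monomial-≢ {zero} {suc m} m≢k = ≡.refl
  coeff-monomial-≢ {suc k} {zero} m≢k = ≡.refl
  coeff-monomial-≢ {suc k} {suc m} m≢k = coeff-monomial-≢ (m≢k ∘ cong suc)

  Diter-coeff : ∀ j (f : Seq) m → Diter j f m ≈ fromℕ (rising m j) * f (m ℕ.+ j)
  Diter-coeff zero f m = sym (begin
    (1# + 0#) * f (m ℕ.+ 0) ≈⟨ *-congʳ (+-identityʳ 1#) ⟩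
    1# * f (m ℕ.+ 0)        ≈⟨ *-identityˡ _ ⟩
    f (m ℕ.+ 0)             ≡⟨ cong f (ℕₚ.+-identityʳ m) ⟩
    f m                     ∎)
  Diter-coeff (suc j) f m = begin
    fromℕ (suc m) * Diter j f (suc m)
      ≈⟨ *-congˡ (Diter-coeff j f (suc m)) ⟩
    fromℕ (suc m) * (fromℕ (rising (suc m) j) * f (suc m ℕ.+ j))
      ≈⟨ *-assoc _ _ _ ⟨
    fromℕ (suc m) * fromℕ (rising (suc m) j) * f (suc m ℕ.+ j)
      ≈⟨ *-congʳ (fromℕ-* (suc m) (rising (suc m) j)) ⟨
    fromℕ (rising m (suc j)) * f (suc m ℕ.+ j)
      ≡⟨ cong (λ i → fromℕ (rising m (suc j)) * f i) (ℕₚ.+-suc m j) ⟨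
    fromℕ (rising m (suc j)) * f (m ℕ.+ suc j)
      ∎

  Diter-monomial-≢ : ∀ j k m → m ℕ.+ j ≢ k → Diter j (coeff (monomial k)) m ≈ 0#
  Diter-monomial-≢ j k m m+j≢k =
    trans (Diter-coeff j _ m) (trans (*-congˡ (reflexive (coeff-monomial-≢ m+j≢k))) (zeroʳ _))

  Diter-monomial-≡ : ∀ j {k m} → m ℕ.+ j ≡ k →
                     Diter j (coeff (monomial k)) m ≈ fromℕ (rising m j)
  Diter-monomial-≡ j {k} {m} ≡.refl =
    trans (Diter-coeff j _ m) (trans (*-congˡ (reflexive (coeff-monomial-≡ k))) (*-identityʳ _))

  -- f is a multiple of x^(k - 1); for k = 0 this forces f = 0
  Concentrated : Seq → ℕ → Set ℓ
  Concentrated f k = ∀ n → suc n ≢ k → f n ≈ 0#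

  mul-Diter-monomial-off : ∀ {f j k n} → Concentrated f j → suc n ≢ k →
                           mul f (Diter j (coeff (monomial k))) n ≈ 0#
  mul-Diter-monomial-off {f} {j} {k} {n} f-conc 1+n≢k = sumBelow-zero (suc n) term
    where
    term : ∀ i → i < suc n → f i * Diter j (coeff (monomial k)) (n ℕ.∸ i) ≈ 0#
    term i i<1+n with suc i ℕ.≟ j
    ... | yes ≡.refl = trans (*-congˡ (Diter-monomial-≢ (suc i) k (n ℕ.∸ i) n∸i+1+i≢k)) (zeroʳ _)
      where
      n∸i+1+i≢k : n ℕ.∸ i ℕ.+ suc i ≢ k
      n∸i+1+i≢k = 1+n≢k ∘ ≡.trans (≡.sym (m∸n+suc[n]≡suc[m] (s≤s⁻¹ i<1+n)))
    ... | no 1+i≢j = trans (*-congʳ (f-conc i 1+i≢j)) (zeroˡ _)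

  mul-Diter-monomial-diagonal : ∀ f k n →
                                mul f (Diter k (coeff (monomial k))) n ≈ f n * fromℕ (k !)
  mul-Diter-monomial-diagonal f k n = begin
    mul f g n
      ≡⟨⟩
    sumBelow n (λ i → f i * g (n ℕ.∸ i)) + f n * g (n ℕ.∸ n)
      ≈⟨ +-cong (sumBelow-zero n below) (*-congˡ top) ⟩
    0# + f n * fromℕ (k !)
      ≈⟨ +-identityˡ _ ⟩
    f n * fromℕ (k !)
      ∎
    where
    g = Diter k (coeff (monomial k))

    below : ∀ i → i < n → f i * g (n ℕ.∸ i) ≈ 0#
    below i i<n = trans (*-congˡ (Diter-monomial-≢ k k (n ℕ.∸ i) (n<m⇒m∸n+k≢k k i<n))) (zeroʳ _)

    top : g (n ℕ.∸ n) ≈ fromℕ (k !)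
    top = begin
      g (n ℕ.∸ n)       ≡⟨ cong g (n∸n≡0 n) ⟩
      g 0               ≈⟨ Diter-monomial-≡ k ≡.refl ⟩
      fromℕ (rising 0 k) ≡⟨ cong fromℕ (rising-zero k) ⟩
      fromℕ (k !)       ∎

  mul-Diter-monomial-on : ∀ {f j m} → Concentrated f j → j ≤ suc m →
    mul f (Diter j (coeff (monomial (suc m)))) m ≈ fromℕ (suc m C j) * (f (pred j) * fromℕ (j !))
  mul-Diter-monomial-on {f} {zero} {m} f-conc _ = begin
    mul f (coeff (monomial (suc m))) m ≈⟨ sumBelow-zero (suc m) (λ i _ → f*≈0 i) ⟩
    0#                                ≈⟨ zeroʳ _ ⟨
    fromℕ 1 * 0#                      ≈⟨ *-congˡ (f*≈0 0) ⟨
    fromℕ 1 * (f 0 * fromℕ 1)         ∎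
    where
    f*≈0 : ∀ i {x} → f i * x ≈ 0#
    f*≈0 i = trans (*-congʳ (f-conc i λ ())) (zeroˡ _)
  mul-Diter-monomial-on {f} {suc j} {m} f-conc 1+j≤1+m = begin
    mul f (Diter (suc j) (coeff (monomial (suc m)))) m
      ≈⟨ sumBelow-single (suc m) (s≤s j≤m) others ⟩
    f j * Diter (suc j) (coeff (monomial (suc m))) (m ℕ.∸ j)
      ≈⟨ *-congˡ (Diter-monomial-≡ (suc j) (m∸n+suc[n]≡suc[m] j≤m)) ⟩
    f j * fromℕ (rising (m ℕ.∸ j) (suc j))
      ≡⟨ cong (λ r → f j * fromℕ r) rising≡C*!′ ⟩
    f j * fromℕ ((suc m C suc j) ℕ.* suc j !)
      ≈⟨ *-congˡ (fromℕ-* (suc m C suc j) (suc j !)) ⟩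
    f j * (fromℕ (suc m C suc j) * fromℕ (suc j !))
      ≈⟨ x∙yz≈y∙xz _ _ _ ⟩
    fromℕ (suc m C suc j) * (f j * fromℕ (suc j !))
      ∎
    where
    j≤m = s≤s⁻¹ 1+j≤1+m

    others : ∀ i → i < suc m → i ≢ j →
             f i * Diter (suc j) (coeff (monomial (suc m))) (m ℕ.∸ i) ≈ 0#
    others i _ i≢j = trans (*-congʳ (f-conc i (i≢j ∘ suc-injective))) (zeroˡ _)

    rising≡C*!′ : rising (m ℕ.∸ j) (suc j) ≡ (suc m C suc j) ℕ.* suc j !
    rising≡C*!′ = ≡.trans (rising≡C*! (m ℕ.∸ j) (suc j))
      (cong (λ t → (t C suc j) ℕ.* suc j !) (m∸n+suc[n]≡suc[m] j≤m))

  module Expansion (charZero : CharZero) (h : Seq) (L : ℕ → Poly)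
    (expansion : ∀ (p : Poly) (n : ℕ) → Dh h (coeff p) n ≈ seriesOp L p n) where

    expansion-monomial : ∀ k n → h (suc n) * coeff (monomial k) (suc n)
      ≈ sumBelow (suc k) (λ j → mul (coeff (L j)) (Diter j (coeff (monomial k))) n)
    expansion-monomial k n = trans (expansion (monomial k) n) (reflexive (cong
      (λ l → sumBelow l (λ j → mul (coeff (L j)) (Diter j (coeff (monomial k))) n))
      (length-monomial k)))

    L-concentrated : ∀ k → Concentrated (coeff (L k)) k
    L-concentrated = <-rec (λ k → Concentrated (coeff (L k)) k) step
      where
      step : ∀ k → (∀ {j} → j < k → Concentrated (coeff (L j)) j) → Concentrated (coeff (L k)) k
      step k lower n 1+n≢k = x*y≈0⇒x≈0 (fromℕ-≉0 charZero (k !) {{k !≢0}}) (begin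
        coeff (L k) n * fromℕ (k !)
          ≈⟨ mul-Diter-monomial-diagonal (coeff (L k)) k n ⟨
        mul (coeff (L k)) (Diter k (coeff (monomial k))) n
          ≈⟨ +-identityˡ _ ⟨
        0# + mul (coeff (L k)) (Diter k (coeff (monomial k))) n
          ≈⟨ +-congʳ (sumBelow-zero k (λ j j<k → mul-Diter-monomial-off (lower j<k) 1+n≢k)) ⟨
        sumBelow (suc k) (λ j → mul (coeff (L j)) (Diter j (coeff (monomial k))) n)
          ≈⟨ expansion-monomial k n ⟨
        h (suc n) * coeff (monomial k) (suc n)
          ≡⟨ cong (h (suc n) *_) (coeff-monomial-≢ 1+n≢k) ⟩
        h (suc n) * 0#
          ≈⟨ zeroʳ _ ⟩
        0#
          ∎)

    scaledCoeff : Seq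
    scaledCoeff j = coeff (L j) (pred j) * fromℕ (j !)

    h≈binomialTransform : h 0 ≈ 0# → ∀ k → h k ≈ binomialTransform scaledCoeff k
    h≈binomialTransform h₀ zero = begin
      h 0                             ≈⟨ h₀ ⟩
      0#                              ≈⟨ zeroˡ _ ⟨
      0# * fromℕ 1                    ≈⟨ *-congʳ (L-concentrated 0 0 λ ()) ⟨
      scaledCoeff 0                   ≈⟨ binomialTransform-zero scaledCoeff ⟨
      binomialTransform scaledCoeff 0 ∎
    h≈binomialTransform h₀ (suc m) = begin
      h (suc m)
        ≈⟨ *-identityʳ _ ⟨
      h (suc m) * 1#
        ≡⟨ cong (h (suc m) *_) (coeff-monomial-≡ (suc m)) ⟨
      h (suc m) * coeff (monomial (suc m)) (suc m)
        ≈⟨ expansion-monomial (suc m) m ⟩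
      sumBelow (suc (suc m)) (λ j → mul (coeff (L j)) (Diter j (coeff (monomial (suc m)))) m)
        ≈⟨ sumBelow-cong (suc (suc m))
             (λ j j<2+m → mul-Diter-monomial-on (L-concentrated j) (s≤s⁻¹ j<2+m)) ⟩
      binomialTransform scaledCoeff (suc m)
        ∎

mainTheorem11 : ∀ {c ℓ} (F : Field c ℓ) →
    let open Field F
        open FieldOps F
    in CharZero →
       (h : Seq) → h 0 ≈ 0# → (∀ k → ¬ (h (suc k) ≈ 0#)) →
       (L : ℕ → Poly) →
       (∀ (p : Poly) (n : ℕ) → Dh h (coeff p) n ≈ seriesOp L p n) →
       ∀ (k n : ℕ) → coeff (L k) n ≈ formulaCoeff h k n
mainTheorem11 F charZero h h₀ _ L expansion = coefficients
  where
  open Field F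
  open FieldOps F
  open Expansion F charZero h L expansion

  coefficients : ∀ k n → coeff (L k) n ≈ formulaCoeff h k n
  coefficients k n with suc n ℕ.≟ k
  ... | yes ≡.refl = x*y≈z⇒x≈y⁻¹*z F (fromℕ-≉0 F charZero (suc n !) {{suc n !≢0}})
                                     (binomial-inversion F (h≈binomialTransform h₀) (suc n))
  ... | no 1+n≢k = L-concentrated k n 1+n≢k
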